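{- Let $\mu=(\mathrm{Val},(\mathcal P,\mathcal O),\varsigma)$ be a model for the predicate symbols $\mathrm{broadcast},\mathrm{echo},\mathrm{ready},\mathrm{deliver}$ whose semitopology $(\mathcal P,\mathcal O)$ is 3-twined, and suppose every axiom of $\mathrm{ThyBB}$ is valid in $\mu$. Then $$\models\exists_{01}a.\,\mathsf{Somewhere}\,\mathrm{deliver}(a).$$
   Context: Truth values: $\mathbf 3=\{\mathbf f,\mathbf b,\mathbf t\}$ totally ordered by $\mathbf f<\mathbf b<\mathbf t$; $\wedge,\vee$ are min and max, $\bigwedge,\bigvee$ are infimum and supremum. Negation: $\neg\mathbf t=\mathbf f$, $\neg\mathbf b=\mathbf b$, $\neg\mathbf f=\mathbf t$. Modalities: $\mathsf T x=\mathbf t$ if $x=\mathbf t$, else $\mathbf f$; $\mathsf B x=\mathbf t$ if $x=\mathbf b$, else $\mathbf f$; $\mathsf{TF}x=\mathbf t$ if $x\in\{\mathbf t,\mathbf f\}$, else $\mathbf f$. Weak implication: $x\to_w y:=\neg x\vee y$. A truth value is valid iff it lies in $\{\mathbf t,\mathbf b\}$. A semitopology $(\mathcal P,\mathcal O)$ is a set $\mathcal P$ with a family $\mathcal O$ of subsets containing $\mathcal P$ and closed under arbitrary (including empty) unions; $\mathcal O^{\neq\emptyset}$ is the set of nonempty members of $\mathcal O$. It is 3-twined if any three members of $\mathcal O^{\neq\emptyset}$ have nonempty intersection. For $f:\mathcal P\to\mathbf 3$: $\mathsf{Everywhere} f=\bigwedge_{p}f(p)$, $\mathsf{Somewhere}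 f=\bigvee_p f(p)$, $\mathsf{Quorum} f=\bigvee_{O\in\mathcal O^{\neq\emptyset}}\bigwedge_{p\in O}f(p)$, $\mathsf{Contraquorum} f=\bigwedge_{O\in\mathcal O^{\neq\emptyset}}\bigvee_{p\in O}f(p)$. Logic: a model $\mu=(\mathrm{Val},(\mathcal P,\mathcal O),\varsigma)$ consists of a nonempty set $\mathrm{Val}$, a semitopology, and for each predicate symbol $R$ a function $\varsigma(R):\mathcal P\to\mathrm{Val}\to\mathbf 3$. Formulas are built from atoms $R(t)$ ($t$ a value or a variable over $\mathrm{Val}$), value equalities $v\doteq v'$ (denoting $\mathbf t$ if $v=v'$, else $\mathbf f$), connectives $\neg,\wedge,\vee,\to_w$, modalities $\mathsf T,\mathsf B,\mathsf{TF}$, operators $\mathsf{Everywhere},\mathsf{Somewhere},\mathsf{Quorum},\mathsf{Contraquorum}$ and quantifiers over $\mathrm{Val}$. Denotation $[\![\phi]\!]:\mathcal P\to\mathbf 3$: $[\![R(v)]\!](p)=\varsigma(R)(p)(v)$; connectives and $\mathsf T,\mathsf B,\mathsf{TF}$ pointwise in $p$; $[\![\mathsf{Quorum}\,\phi]\!](p)=\mathsf{Quorum}([\![\phi]\!])$ for all $p$, likewise for the other three operators; $[\![\exists a.\phi]\!](p)=\bigvee_{v}[\![\phi[a:=v]]\!](p)$, $[\![\forall a.\phi]\!](p)=\bigwedge_{v}[\![\phi[a:=v]]\!](p)$; $[\![\exists_{01}a.\phi]\!](p)=\bigwedge_{v,v'}\big(([\![\phi[a:=v]]\!](p)\wedge[\![\phi[a:=v']]\!](p))\to_w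 (v\doteq v')\big)$; $\exists_1 a.\phi:=(\exists_{01}a.\phi)\wedge(\exists a.\phi)$. $p\models\phi$ iff $[\![\phi]\!](p)\in\{\mathbf t,\mathbf b\}$; $\models\phi$ iff $p\models\phi$ for all $p$. $\mathrm{correct}(R):=\forall a.\mathsf{TF}R(a)$, $\mathrm{incorrect}(R):=\forall a.\mathsf B R(a)$. Axioms with a free variable $a$ are universally quantified over $a$; an axiom is valid in $\mu$ if $\models$ it. $\mathrm{ThyBB}$ consists of: BrDeliver?: $\mathrm{deliver}(a)\to_w\mathsf{Quorum}\,\mathrm{ready}(a)$; BrReady?: $\mathrm{ready}(a)\to_w\mathsf{Quorum}\,\mathrm{echo}(a)$; BrEcho?: $\mathrm{echo}(a)\to_w\mathsf{Somewhere}\,\mathrm{broadcast}(a)$; BrEcho01: $\exists_{01}a.\mathrm{echo}(a)$; BrBroadcast1: $\exists_1 a.\mathsf{Somewhere}\,\mathrm{broadcast}(a)$; BrDeliver!: $\mathsf{Quorum}\,\mathrm{ready}(a)\to_w\mathrm{deliver}(a)$; BrReady!: $\mathsf{Quorum}\,\mathrm{echo}(a)\to_w\mathrm{ready}(a)$; BrEcho!: $\mathsf{Somewhere}\,\mathrm{broadcast}(a)\to_w\exists a.\mathrm{echo}(a)$; BrReady!!: $\mathsf{Contraquorum}\,\mathrm{ready}(a)\to_w\mathrm{ready}(a)$; BrCorrect: $\mathsf{Quorum}\,\mathrm{correct}(\mathrm{ready})\wedge\mathsf{Quorum}\,\mathrm{correct}(\mathrm{echo})$; BrCorrect': $\mathrm{correct}(R)\vee\mathrm{incorrect}(R)$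 for $R\in\{\mathrm{ready},\mathrm{echo}\}$; BrCorrect'': $\mathsf{Everywhere}\,\mathrm{correct}(\mathrm{broadcast})\vee\mathsf{Everywhere}\,\mathrm{incorrect}(\mathrm{broadcast})$. -}

module Defs where

open import Level using (Level; Setω)
open import Data.Product using (Σ; _×_; _,_; ∃; proj₁; proj₂)
open import Data.Unit using (⊤)
open import Relation.Binary.PropositionalEquality using (_≡_)
open import Function.Bundles using (_⇔_)

data 𝟛 : Set where
  𝐟 𝐛 𝐭 : 𝟛

data _≤₃_ : 𝟛 → 𝟛 → Set where
  f≤f : 𝐟 ≤₃ 𝐟
  f≤b : 𝐟 ≤₃ 𝐛
  f≤t : 𝐟 ≤₃ 𝐭
  b≤b : 𝐛 ≤₃ 𝐛
  b≤t : 𝐛 ≤₃ 𝐭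
  t≤t : 𝐭 ≤₃ 𝐭

_∧₃_ : 𝟛 → 𝟛 → 𝟛
𝐟 ∧₃ y = 𝐟
𝐛 ∧₃ 𝐟 = 𝐟
𝐛 ∧₃ 𝐛 = 𝐛
𝐛 ∧₃ 𝐭 = 𝐛
𝐭 ∧₃ y = y

_∨₃_ : 𝟛 → 𝟛 → 𝟛
𝐟 ∨₃ y = y
𝐛 ∨₃ 𝐟 = 𝐛
𝐛 ∨₃ 𝐛 = 𝐛
𝐛 ∨₃ 𝐭 = 𝐭
𝐭 ∨₃ y = 𝐭

¬₃_ : 𝟛 → 𝟛
¬₃ 𝐭 = 𝐟
¬₃ 𝐛 = 𝐛
¬₃ 𝐟 = 𝐭

_→w_ : 𝟛 → 𝟛 → 𝟛
x →w y = (¬₃ x) ∨₃ y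

𝖳 : 𝟛 → 𝟛
𝖳 𝐭 = 𝐭
𝖳 𝐛 = 𝐟
𝖳 𝐟 = 𝐟

𝖡 : 𝟛 → 𝟛
𝖡 𝐭 = 𝐟
𝖡 𝐛 = 𝐭
𝖡 𝐟 = 𝐟

𝖳𝖥 : 𝟛 → 𝟛
𝖳𝖥 𝐭 = 𝐭
𝖳𝖥 𝐛 = 𝐟
𝖳𝖥 𝐟 = 𝐭

data Valid : 𝟛 → Set where
  valid-t : Valid 𝐭
  valid-b : Valid 𝐛

-- Arbitrary infima/suprema over arbitrary
-- index types are not computable constructively, so they are supplied
-- as operations together with their defining (glb / lub) specification.
-- Such operations exist (classically) and are unique, so quantifying
-- over them is faithful.

record Complete𝟛 : Setω where
  field
    ⋀ : ∀ {ℓ} {I : Set ℓ} → (I → 𝟛) → 𝟛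
    ⋁ : ∀ {ℓ} {I : Set ℓ} → (I → 𝟛) → 𝟛
    ⋀-lower    : ∀ {ℓ} {I : Set ℓ} (g : I → 𝟛) (i : I) → ⋀ g ≤₃ g i
    ⋀-greatest : ∀ {ℓ} {I : Set ℓ} (g : I → 𝟛) (x : 𝟛) →
                 (∀ i → x ≤₃ g i) → x ≤₃ ⋀ g
    ⋁-upper    : ∀ {ℓ} {I : Set ℓ} (g : I → 𝟛) (i : I) → g i ≤₃ ⋁ g
    ⋁-least    : ∀ {ℓ} {I : Set ℓ} (g : I → 𝟛) (x : 𝟛) →
                 (∀ i → g i ≤₃ x) → ⋁ g ≤₃ x

record Semitopology : Set₁ where
  field
    P      : Set
    Open   : (P → Set) → Set
    Open-ext   : ∀ {U V : P → Set} → Open U → (∀ p → U p ⇔ V p) → Open V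
    Open-full  : Open (λ _ → ⊤)
    Open-union : ∀ {I : Set} (U : I → P → Set) → (∀ i → Open (U i)) →
                 Open (λ p → Σ I (λ i → U i p))

  NEOpen : Set₁
  NEOpen = Σ (P → Set) (λ O → Open O × ∃ O)

  ThreeTwined : Set₁
  ThreeTwined = (O₁ O₂ O₃ : NEOpen) →
    ∃ λ p → proj₁ O₁ p × proj₁ O₂ p × proj₁ O₃ p

record Model : Set₁ where
  field
    Val  : Set
    val₀ : Val
    topo : Semitopology
  open Semitopology topo public
  field
    broadcast echo ready deliver : P → Val → 𝟛

module Semantics (C : Complete𝟛) (M : Model) where
  open Complete𝟛 C
  open Model M

  Everywhere : (P → 𝟛) → 𝟛
  Everywhere g = ⋀ g

  Somewhere : (P → 𝟛) → 𝟛
  Somewhere g = ⋁ g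

  Quorum : (P → 𝟛) → 𝟛
  Quorum g = ⋁ {I = NEOpen} (λ O → ⋀ {I = Σ P (proj₁ O)} (λ q → g (proj₁ q)))

  Contraquorum : (P → 𝟛) → 𝟛
  Contraquorum g = ⋀ {I = NEOpen} (λ O → ⋁ {I = Σ P (proj₁ O)} (λ q → g (proj₁ q)))

  -- value equality v ≐ v' : t if v = v', else f
  -- (written as the supremum of the constant t over the proofs of v ≡ v',
  --  which is t if v ≡ v' and f otherwise)
  _≐_ : Val → Val → 𝟛
  v ≐ v' = ⋁ {I = v ≡ v'} (λ _ → 𝐭)

  Exists : (Val → 𝟛) → 𝟛
  Exists g = ⋁ g

  Forall : (Val → 𝟛) → 𝟛
  Forall g = ⋀ g

  Exists01 : (Val → 𝟛) → 𝟛
  Exists01 g = ⋀ {I = Val × Val}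
    (λ vv → (g (proj₁ vv) ∧₃ g (proj₂ vv)) →w (proj₁ vv ≐ proj₂ vv))

  Exists1 : (Val → 𝟛) → 𝟛
  Exists1 g = Exists01 g ∧₃ Exists g

  correct : (P → Val → 𝟛) → P → 𝟛
  correct R p = Forall (λ a → 𝖳𝖥 (R p a))

  incorrect : (P → Val → 𝟛) → P → 𝟛
  incorrect R p = Forall (λ a → 𝖡 (R p a))

  ⊨_ : (P → 𝟛) → Set
  ⊨ φ = ∀ p → Valid (φ p)

  record ThyBB : Set₁ where
    field
      BrDeliver? : ∀ a → ⊨ (λ p → deliver p a →w Quorum (λ q → ready q a))
      BrReady?   : ∀ a → ⊨ (λ p → ready p a →w Quorum (λ q → echo q a))
      BrEcho?    : ∀ a → ⊨ (λ p → echo p a →w Somewhere (λ q → broadcast q a))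
      BrEcho01   : ⊨ (λ p → Exists01 (λ a → echo p a))
      BrBroadcast1 : ⊨ (λ p → Exists1 (λ a → Somewhere (λ q → broadcast q a)))
      BrDeliver! : ∀ a → ⊨ (λ p → Quorum (λ q → ready q a) →w deliver p a)
      BrReady!   : ∀ a → ⊨ (λ p → Quorum (λ q → echo q a) →w ready p a)
      BrEcho!    : ∀ a → ⊨ (λ p → Somewhere (λ q → broadcast q a) →w
                                  Exists (λ a' → echo p a'))
      BrReady!!  : ∀ a → ⊨ (λ p → Contraquorum (λ q → ready q a) →w ready p a)
      BrCorrect  : ⊨ (λ p → Quorum (correct ready) ∧₃ Quorum (correct echo))
      BrCorrect'-ready : ⊨ (λ p → correct ready p ∨₃ incorrect ready p)
      BrCorrect'-echo  : ⊨ (λ p → correct echo p ∨₃ incorrect echo p)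
      BrCorrect'' : ⊨ (λ p → Everywhere (correct broadcast) ∨₃
                              Everywhere (incorrect broadcast))

-- If a and a' are both delivered with value t somewhere, BrDeliver? gives
-- valid ready-quorums for a and for a'.  Three-twinedness makes them meet
-- a quorum of points that are correct for ready, and at a correct point a
-- valid value is t, so some point is ready for both a and a' with t.
-- Repeating the argument one level down (BrReady?, the echo-correctness
-- quorum) yields a point echoing both with t, where BrEcho01 forces a ≐ a'.
-- If Somewhere deliver is only b, the weak implication is valid anyway.
-- The points are only obtained under a double negation, which is harmless
-- because validity of a truth value is stable.
module Submission where

open import Defs
open import Data.Product using (Σ; _×_; _,_; ∃; proj₁)
open import Data.Empty using (⊥-elim)
open import Relation.Nullary using (¬_; Stable)
open import Relation.Binary.PropositionalEquality using (_≡_; refl; subst; cong₂)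

≤₃-trans : ∀ {x y z} → x ≤₃ y → y ≤₃ z → x ≤₃ z
≤₃-trans f≤f q   = q
≤₃-trans f≤b b≤b = f≤b
≤₃-trans f≤b b≤t = f≤t
≤₃-trans f≤t t≤t = f≤t
≤₃-trans b≤b q   = q
≤₃-trans b≤t t≤t = b≤t
≤₃-trans t≤t t≤t = t≤t

Valid⇒𝐛≤ : ∀ {x} → Valid x → 𝐛 ≤₃ x
Valid⇒𝐛≤ valid-t = b≤t
Valid⇒𝐛≤ valid-b = b≤b

𝐛≤⇒Valid : ∀ {x} → 𝐛 ≤₃ x → Valid x
𝐛≤⇒Valid b≤b = valid-b
𝐛≤⇒Valid b≤t = valid-t

Valid-upward : ∀ {x y} → Valid x → x ≤₃ y → Valid y
Valid-upward v x≤y = 𝐛≤⇒Valid (≤₃-trans (Valid⇒𝐛≤ v) x≤y)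

¬Valid⇒≤𝐟 : ∀ {x} → ¬ Valid x → x ≤₃ 𝐟
¬Valid⇒≤𝐟 {𝐟} _ = f≤f
¬Valid⇒≤𝐟 {𝐛} h = ⊥-elim (h valid-b)
¬Valid⇒≤𝐟 {𝐭} h = ⊥-elim (h valid-t)

≢𝐭⇒≤𝐛 : ∀ {x} → ¬ x ≡ 𝐭 → x ≤₃ 𝐛
≢𝐭⇒≤𝐛 {𝐟} _ = f≤b
≢𝐭⇒≤𝐛 {𝐛} _ = b≤b
≢𝐭⇒≤𝐛 {𝐭} h = ⊥-elim (h refl)

Valid-stable : ∀ {x} → Stable (Valid x)
Valid-stable {𝐟} h = ⊥-elim (h (λ ()))
Valid-stable {𝐛} _ = valid-b
Valid-stable {𝐭} _ = valid-t

Valid-∧₃ˡ : ∀ {x y} → Valid (x ∧₃ y) → Valid x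
Valid-∧₃ˡ {𝐛} {𝐛} _ = valid-b
Valid-∧₃ˡ {𝐛} {𝐭} _ = valid-b
Valid-∧₃ˡ {𝐭}     _ = valid-t

Valid-∧₃ʳ : ∀ {x y} → Valid (x ∧₃ y) → Valid y
Valid-∧₃ʳ {𝐛} {𝐛} _ = valid-b
Valid-∧₃ʳ {𝐛} {𝐭} _ = valid-t
Valid-∧₃ʳ {𝐭}     v = v

∧₃≡𝐭 : ∀ {x y} → x ∧₃ y ≡ 𝐭 → x ≡ 𝐭 × y ≡ 𝐭
∧₃≡𝐭 {𝐟} ()
∧₃≡𝐭 {𝐛} {𝐟} ()
∧₃≡𝐭 {𝐛} {𝐛} ()
∧₃≡𝐭 {𝐛} {𝐭} ()
∧₃≡𝐭 {𝐭} {𝐭} _ = refl , refl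

→w-mp : ∀ {x y} → Valid (x →w y) → x ≡ 𝐭 → Valid y
→w-mp v refl = v

-- ¬₃ 𝐛 = 𝐛 is valid, so only a premise 𝐭 imposes anything.
Valid-→w : ∀ x {y} → (x ≡ 𝐭 → Valid y) → Valid (x →w y)
Valid-→w 𝐟 _ = valid-t
Valid-→w 𝐛 {𝐟} _ = valid-b
Valid-→w 𝐛 {𝐛} _ = valid-b
Valid-→w 𝐛 {𝐭} _ = valid-t
Valid-→w 𝐭 h = h refl

Valid-𝖳𝖥⇒≡𝐭 : ∀ {x} → Valid (𝖳𝖥 x) → Valid x → x ≡ 𝐭
Valid-𝖳𝖥⇒≡𝐭 {𝐭} _ _ = refl

module CompleteLattice (C : Complete𝟛) where
  open Complete𝟛 C

  ⋁≡𝐭⇒¬¬∃≡𝐭 : ∀ {ℓ} {I : Set ℓ} (g : I → 𝟛) → ⋁ g ≡ 𝐭 → ¬ ¬ (∃ λ i → g i ≡ 𝐭)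
  ⋁≡𝐭⇒¬¬∃≡𝐭 g e k with subst (_≤₃ 𝐛) e (⋁-least g 𝐛 (λ i → ≢𝐭⇒≤𝐛 (λ gi≡𝐭 → k (i , gi≡𝐭))))
  ... | ()

  Valid-⋁⇒¬¬∃Valid : ∀ {ℓ} {I : Set ℓ} (g : I → 𝟛) → Valid (⋁ g) → ¬ ¬ (∃ λ i → Valid (g i))
  Valid-⋁⇒¬¬∃Valid g v k with Valid-upward v (⋁-least g 𝐟 (λ i → ¬Valid⇒≤𝐟 (λ vi → k (i , vi))))
  ... | ()

  Valid-⋀⇒∀Valid : ∀ {ℓ} {I : Set ℓ} (g : I → 𝟛) → Valid (⋀ g) → ∀ i → Valid (g i)
  Valid-⋀⇒∀Valid g v i = Valid-upward v (⋀-lower g i)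

  ∀Valid⇒Valid-⋀ : ∀ {ℓ} {I : Set ℓ} (g : I → 𝟛) → (∀ i → Valid (g i)) → Valid (⋀ g)
  ∀Valid⇒Valid-⋀ g v = 𝐛≤⇒Valid (⋀-greatest g 𝐛 (λ i → Valid⇒𝐛≤ (v i)))

module Quorums (C : Complete𝟛) (M : Model) where
  open CompleteLattice C
  open Model M
  open Semantics C M

  Valid-Quorum⇒¬¬ValidOn : (g : P → 𝟛) → Valid (Quorum g) →
    ¬ ¬ (Σ NEOpen λ O → ∀ q → proj₁ O q → Valid (g q))
  Valid-Quorum⇒¬¬ValidOn g v k =
    Valid-⋁⇒¬¬∃Valid _ v λ { (O , vO) → k (O , λ q q∈O → Valid-⋀⇒∀Valid _ vO (q , q∈O)) }

  correct⇒Valid⇒≡𝐭 : (R : P → Val → 𝟛) {q : P} → Valid (correct R q) →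
    ∀ a → Valid (R q a) → R q a ≡ 𝐭
  correct⇒Valid⇒≡𝐭 R c a = Valid-𝖳𝖥⇒≡𝐭 (Valid-⋀⇒∀Valid _ c a)

  quorums-meet-correctly : ThreeTwined → (R : P → Val → 𝟛) → ∀ a a' →
    Valid (Quorum (correct R)) →
    Valid (Quorum (λ q → R q a)) → Valid (Quorum (λ q → R q a')) →
    ¬ ¬ (∃ λ p → R p a ≡ 𝐭 × R p a' ≡ 𝐭)
  quorums-meet-correctly tw R a a' c qa qa' k =
    Valid-Quorum⇒¬¬ValidOn _ qa λ { (Oa , ha) →
    Valid-Quorum⇒¬¬ValidOn _ qa' λ { (Oa' , ha') →
    Valid-Quorum⇒¬¬ValidOn _ c λ { (Oc , hc) →
      let (p , p∈Oa , p∈Oa' , p∈Oc) = tw Oa Oa' Oc in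
      k (p , correct⇒Valid⇒≡𝐭 R (hc p p∈Oc) a (ha p p∈Oa)
           , correct⇒Valid⇒≡𝐭 R (hc p p∈Oc) a' (ha' p p∈Oa')) } } }

module Agreement (C : Complete𝟛) (M : Model) (tw : Semitopology.ThreeTwined (Model.topo M))
                 (T : Semantics.ThyBB C M) where
  open CompleteLattice C
  open Quorums C M
  open Model M
  open Semantics C M
  open ThyBB T

  delivered : Val → 𝟛
  delivered a = Somewhere (λ q → deliver q a)

  ready-both : ∀ a a' q q' → deliver q a ≡ 𝐭 → deliver q' a' ≡ 𝐭 →
    ¬ ¬ (∃ λ p → ready p a ≡ 𝐭 × ready p a' ≡ 𝐭)
  ready-both a a' q q' dq dq' =
    quorums-meet-correctly tw ready a a' (Valid-∧₃ˡ (BrCorrect q))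
      (→w-mp (BrDeliver? a q) dq) (→w-mp (BrDeliver? a' q') dq')

  echo-both : ∀ a a' p → ready p a ≡ 𝐭 → ready p a' ≡ 𝐭 →
    ¬ ¬ (∃ λ r → echo r a ≡ 𝐭 × echo r a' ≡ 𝐭)
  echo-both a a' p rp rp' =
    quorums-meet-correctly tw echo a a' (Valid-∧₃ʳ (BrCorrect p))
      (→w-mp (BrReady? a p) rp) (→w-mp (BrReady? a' p) rp')

  echo-unique : ∀ a a' r → echo r a ≡ 𝐭 → echo r a' ≡ 𝐭 → Valid (a ≐ a')
  echo-unique a a' r er er' =
    →w-mp (Valid-⋀⇒∀Valid _ (BrEcho01 r) (a , a')) (cong₂ _∧₃_ er er')

  delivered-unique : ∀ a a' → delivered a ≡ 𝐭 → delivered a' ≡ 𝐭 → Valid (a ≐ a')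
  delivered-unique a a' da da' = Valid-stable λ k →
    ⋁≡𝐭⇒¬¬∃≡𝐭 _ da λ { (q , dq) →
    ⋁≡𝐭⇒¬¬∃≡𝐭 _ da' λ { (q' , dq') →
    ready-both a a' q q' dq dq' λ { (p , rp , rp') →
    echo-both a a' p rp rp' λ { (r , er , er') →
    k (echo-unique a a' r er er') } } } }

  delivered-Exists01 : ⊨ (λ _ → Exists01 delivered)
  delivered-Exists01 _ = ∀Valid⇒Valid-⋀ _ λ { (a , a') →
    Valid-→w (delivered a ∧₃ delivered a') λ both →
      let (da , da') = ∧₃≡𝐭 both in delivered-unique a a' da da' }

proposition4p17 : (C : Complete𝟛) (M : Model) →
    Semitopology.ThreeTwined (Model.topo M) →
    Semantics.ThyBB C M →
    Semantics.⊨_ C M (λ p → Semantics.Exists01 C M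
      (λ a → Semantics.Somewhere C M (λ q → Model.deliver M q a)))
proposition4p17 C M tw T = Agreement.delivered-Exists01 C M tw T
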